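{- Let $k\geq 3$, let $\widehat G$ be a finite simple graph, let $d$ be a positive integer, and let $f\in\mathcal{F}_d(\widehat G^{(k)})$ be such that $D=D_f$ is Eulerian. Let $D^*$ be the multi-digraph obtained from $D$ by deleting all core vertices (and their incident arcs). Then $D^*$ is Eulerian.
   Context: $\widehat G^{(k)}$ is the $k$-uniform hypergraph obtained from $\widehat G$ by adding to each edge $\{i,j\}$ a set $\mathcal{N}_{ij}$ of $k-2$ new vertices (core vertices), distinct for distinct edges; the hyperedge is $\{i,j\}^{(k)}=\{i,j\}\cup\mathcal{N}_{ij}$. Fix a labelling of the vertices of $\widehat G^{(k)}$ by $1,\ldots,n$. $\mathcal{F}_d(\widehat G^{(k)})$ is the set of $d$-tuples $f=(i_1\alpha_1,\ldots,i_d\alpha_d)$ with $i_1\le\cdots\le i_d$, where each $i_j\alpha_j=(i_j,v^{(j)}_1,\ldots,v^{(j)}_{k-1})$ is a sequence whose underlying set $e_j$ is a hyperedge of $\widehat G^{(k)}$, and such that $\{e_1,\ldots,e_d\}$ is the full set of hyperedges of $\widehat G^{(k)}$. $D_f$ is the multi-digraph on the vertex set of $\widehat G^{(k)}$ whose multiset of arcs is the union over $j$ of the arcs $(i_j,v^{(j)}_1),\ldots,(i_j,v^{(j)}_{k-1})$. A multi-digraph is Eulerian if it has a closed walk traversing every arc exactly once (counting multiplicity). -}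

module Defs where

open import Data.Nat using (ℕ; zero; suc; _≤_; _<_; _∸_)
open import Data.Fin using (Fin; toℕ)
open import Data.Product using (Σ; ∃; _×_; _,_; proj₁; proj₂)
open import Data.Sum using (_⊎_; inj₁; inj₂)
open import Data.List using (List; []; _∷_; length; lookup; map; concatMap; filter)
open import Data.List.Relation.Unary.Unique.Propositional using (Unique)
open import Data.List.Relation.Unary.All using (All)
open import Data.List.Relation.Binary.Permutation.Propositional using (_↭_)
open import Data.Vec using (Vec; toList)
open import Data.Vec.Membership.Propositional using (_∈_)
open import Relation.Binary.PropositionalEquality using (_≡_)
open import Relation.Nullary using (Dec; yes; no)
open import Function.Bundles using (_⇔_; _⤖_; Bijection)

record SimpleGraph : Set where
  field
    m       : ℕ
    edges   : List (Fin m × Fin m)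
    ordered : All (λ e → toℕ (proj₁ e) < toℕ (proj₂ e)) edges
    nodup   : Unique edges

module _ (G : SimpleGraph) (k : ℕ) where
  open SimpleGraph G

  -- index set of edges of Ĝ (= of hyperedges of Ĝ^(k))
  Edge : Set
  Edge = Fin (length edges)

  -- vertices of Ĝ^(k): original vertices, or the t-th core vertex of edge e
  -- (k - 2 core vertices per edge, distinct for distinct edges)
  V : Set
  V = Fin m ⊎ (Edge × Fin (k ∸ 2))

  InHyperedge : Edge → V → Set
  InHyperedge e v =
    (v ≡ inj₁ (proj₁ (lookup edges e))) ⊎
    (v ≡ inj₁ (proj₂ (lookup edges e))) ⊎
    (Σ (Fin (k ∸ 2)) λ t → v ≡ inj₂ (e , t))

  -- an entry  iα = (i , v₁ , … , v_{k-1})  of a tuple in F_d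
  Entry : Set
  Entry = V × Vec V (k ∸ 1)

  InEntry : Entry → V → Set
  InEntry (i , α) v = (v ≡ i) ⊎ (v ∈ α)

  SpansHyperedge : Entry → Edge → Set
  SpansHyperedge x e = ∀ v → InEntry x v ⇔ InHyperedge e v

  -- f ∈ F_d(Ĝ^(k)) with respect to a labelling lab of the vertices by Fin n
  InF : (n : ℕ) → V ⤖ Fin n → (d : ℕ) → Vec Entry d → Set
  InF n lab d f =
      (∀ (a : Fin d) → Σ Edge λ e → SpansHyperedge (Data.Vec.lookup f a) e)
    × (∀ (a b : Fin d) → toℕ a ≤ toℕ b →
         toℕ (Bijection.to lab (proj₁ (Data.Vec.lookup f a)))
           ≤ toℕ (Bijection.to lab (proj₁ (Data.Vec.lookup f b))))
    × (∀ (e : Edge) → Σ (Fin d) λ a → SpansHyperedge (Data.Vec.lookup f a) e)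

  entryArcs : Entry → List (V × V)
  entryArcs (i , α) = map (λ v → (i , v)) (toList α)

  arcsD : {d : ℕ} → Vec Entry d → List (V × V)
  arcsD f = concatMap entryArcs (toList f)

  restrict : V × V → List (Fin m × Fin m)
  restrict (inj₁ u , inj₁ v) = (u , v) ∷ []
  restrict (inj₁ u , inj₂ _) = []
  restrict (inj₂ _ , _)      = []

  arcsDstar : {d : ℕ} → Vec Entry d → List (Fin m × Fin m)
  arcsDstar f = concatMap restrict (arcsD f)

WalkFromTo : {W : Set} → W → List (W × W) → W → Set
WalkFromTo x []             y = x ≡ y
WalkFromTo x ((u , v) ∷ as) y = (x ≡ u) × WalkFromTo v as y

-- A multi-digraph (vertex type W, multiset of arcs as a list) is Eulerian
-- if some closed walk traverses every arc exactly once (counting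
-- multiplicity), i.e. some rearrangement of the arcs forms a closed walk.
-- The arc-less multi-digraph is Eulerian (empty closed walk).
Eulerian : {W : Set} → List (W × W) → Set
Eulerian {W} arcs =
  Σ (List (W × W)) λ w → (w ↭ arcs) × ((w ≡ []) ⊎ (Σ W λ x → WalkFromTo x w x))

-- Weighing the vertices of Ĝ^(k) by an arbitrary h, the balance of D says that
-- (k − 1) · Σⱼ h(iⱼ) = Σⱼ Σₜ h(v⁽ʲ⁾ₜ), and an entry spanning {i,j}^(k) contributes
-- to the right-hand side the weight of its hyperedge minus h(iⱼ).  An entry
-- contributes one arc to D*, from its head to the other end of its edge, if its
-- head is original, and none otherwise.  Using the two weights "h on original
-- vertices" and "h(i) + h(j) on the core vertices of {i,j}" turns the balance
-- of D into the balance of D*.  The indicator of the core vertices of a single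
-- edge {i,j} shows in the same way that some entry spanning {i,j}^(k) has an
-- original head, so i and j are joined in D*; a colouring of Ĝ constant along
-- D* therefore extends to one constant along D, and D* inherits connectivity
-- from D.  Euler's theorem, proved by splicing closed trails, concludes.

module Submission where

open import Defs
open import Data.Bool using (Bool; true; false)
open import Data.Empty using (⊥-elim)
open import Data.Fin as Fin using (Fin)
open import Data.Fin.Properties using () renaming (_≟_ to _≟ᶠ_)
open import Data.List using (List; []; _∷_; _++_; length; lookup; map; concatMap; tabulate)
open import Data.List.Properties using (map-++; map-cong; map-cong-local; map-∘; length-tabulate; ++-assoc; ++-identityʳ; length-++)
open import Data.List.Membership.Propositional using (_∈_; find; lose)
open import Data.List.Membership.Propositional.Properties using (∈-∃++; ∈-map⁺; ∈-map⁻; ∈-lookup; ∈-tabulate⁻; ∈-++⁺ˡ; ∈-++⁺ʳ; ∈-++⁻; ∈-concatMap⁺; ∈-concatMap⁻)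
open import Data.List.Relation.Binary.Permutation.Propositional using (module PermutationReasoning; _↭_; prep; ↭-refl; ↭-reflexive; ↭-sym; ↭-trans)
open import Data.List.Relation.Binary.Permutation.Propositional.Properties using (shift; map⁺; ↭-length; ∈-resp-↭; ++⁺ˡ; ++⁺ʳ; ++-comm)
open import Data.List.Relation.Binary.Subset.Propositional using (_⊆_)
open import Data.List.Relation.Unary.All using (All; []; _∷_)
import Data.List.Relation.Unary.All as All
open import Data.List.Relation.Unary.Any using (here; there; any?)
open import Data.List.Relation.Unary.Unique.Propositional using (Unique; []; _∷_)
import Data.List.Relation.Unary.Unique.Propositional.Properties as Unique
open import Data.Nat using (ℕ; zero; suc; _+_; _*_; _<_; _≤_; s≤s)
open import Data.Nat.Induction using (<-wellFounded)
open import Data.Nat.ListAction using (sum)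
open import Data.Nat.ListAction.Properties using (sum-++; sum-↭)
open import Data.Nat.Properties using (+-assoc; +-cancelˡ-≡; +-cancelʳ-≡; *-distribˡ-+; *-zeroʳ; *-identityʳ; +-identityʳ; *-cancelˡ-≡; m+n≡0⇒m≡0; m+n≡0⇒n≡0; suc-injective; 1+n≢0; 0≢1+n; ≤-reflexive; +-commutativeSemigroup; m≤n+m; <-irrefl; module ≤-Reasoning)
open import Data.Nat.Tactic.RingSolver using (solve-∀)
open import Algebra.Properties.CommutativeSemigroup +-commutativeSemigroup using (x∙yz≈y∙xz)
open import Data.Vec using (Vec; toList)
import Data.Vec.Relation.Unary.All.Properties as VecAll
open import Data.Vec.Properties using (length-toList)
open import Data.Vec.Membership.Propositional.Properties using (∈-toList⁺; ∈-toList⁻) renaming (∈-lookup to ∈-lookupᵛ)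
open import Function.Bundles using (Equivalence; _⤖_)
open import Data.Product.Properties using (≡-dec)
open import Data.Product using (Σ; ∃; ∃₂; _×_; _,_; proj₁; proj₂)
open import Data.Sum using (_⊎_; inj₁; inj₂)
open import Function using (_∘_; case_of_)
open import Induction.WellFounded using (Acc; acc)
open import Relation.Binary.Definitions using (DecidableEquality)
open import Relation.Binary.PropositionalEquality using (_≡_; _≢_; _≗_; refl; sym; trans; cong; cong₂; subst; module ≡-Reasoning)
open import Relation.Nullary using (Dec; yes; no; does; ¬_; contradiction)
open import Relation.Nullary.Decidable using (_⊎-dec_; dec-true; dec-false)

-- Weighted sums over lists

sumBy : {A : Set} → (A → ℕ) → List A → ℕ
sumBy g xs = sum (map g xs)

private
  variable
    A B : Set

sumBy-++ : (g : A → ℕ) (xs ys : List A) → sumBy g (xs ++ ys) ≡ sumBy g xs + sumBy g ys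
sumBy-++ g xs ys = trans (cong sum (map-++ g xs ys)) (sum-++ (map g xs) (map g ys))

sumBy-↭ : (g : A → ℕ) {xs ys : List A} → xs ↭ ys → sumBy g xs ≡ sumBy g ys
sumBy-↭ g p = sum-↭ (map⁺ g p)

sumBy-cong : {g g′ : A → ℕ} → g ≗ g′ → (xs : List A) → sumBy g xs ≡ sumBy g′ xs
sumBy-cong g≗g′ xs = cong sum (map-cong g≗g′ xs)

sumBy-cong-local : {g g′ : A → ℕ} {xs : List A} → All (λ x → g x ≡ g′ x) xs → sumBy g xs ≡ sumBy g′ xs
sumBy-cong-local eqs = cong sum (map-cong-local eqs)

sumBy-+ : (g g′ : A → ℕ) (xs : List A) → sumBy (λ x → g x + g′ x) xs ≡ sumBy g xs + sumBy g′ xs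
sumBy-+ g g′ []       = refl
sumBy-+ g g′ (x ∷ xs) = trans (cong (g x + g′ x +_) (sumBy-+ g g′ xs)) (shuffle (g x) (g′ x) _ _)
  where
  shuffle : ∀ a b c d → a + b + (c + d) ≡ a + c + (b + d)
  shuffle = solve-∀

sumBy-*ˡ : (n : ℕ) (g : A → ℕ) (xs : List A) → sumBy (λ x → n * g x) xs ≡ n * sumBy g xs
sumBy-*ˡ n g []       = sym (*-zeroʳ n)
sumBy-*ˡ n g (x ∷ xs) = trans (cong (n * g x +_) (sumBy-*ˡ n g xs)) (sym (*-distribˡ-+ n (g x) _))

sumBy-const : (n : ℕ) (xs : List A) → sumBy (λ _ → n) xs ≡ length xs * n
sumBy-const n []       = refl
sumBy-const n (x ∷ xs) = cong (n +_) (sumBy-const n xs)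

sumBy-map : (g : B → ℕ) (F : A → B) (xs : List A) → sumBy g (map F xs) ≡ sumBy (g ∘ F) xs
sumBy-map g F xs = cong sum (sym (map-∘ xs))

sumBy-concatMap : (g : B → ℕ) (F : A → List B) (xs : List A) →
  sumBy g (concatMap F xs) ≡ sumBy (sumBy g ∘ F) xs
sumBy-concatMap g F []       = refl
sumBy-concatMap g F (x ∷ xs) = trans (sumBy-++ g (F x) (concatMap F xs)) (cong (sumBy g (F x) +_) (sumBy-concatMap g F xs))

sumBy-tabulate-const : (g : A → ℕ) {n : ℕ} (F : Fin n → A) {v : ℕ} → (∀ t → g (F t) ≡ v) →
  sumBy g (tabulate F) ≡ n * v
sumBy-tabulate-const g {zero}  F gF≡v = refl
sumBy-tabulate-const g {suc n} F gF≡v = cong₂ _+_ (gF≡v Fin.zero) (sumBy-tabulate-const g (F ∘ Fin.suc) (gF≡v ∘ Fin.suc))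

∈-sumBy-≢0 : (g : A → ℕ) {x : A} {xs : List A} → x ∈ xs → g x ≢ 0 → sumBy g xs ≢ 0
∈-sumBy-≢0 g (here refl) gx≢0 eq = gx≢0 (m+n≡0⇒m≡0 _ eq)
∈-sumBy-≢0 g {xs = y ∷ xs} (there x∈) gx≢0 eq = ∈-sumBy-≢0 g x∈ gx≢0 (m+n≡0⇒n≡0 (g y) eq)

∈⇒↭∷ : {x : A} {xs : List A} → x ∈ xs → ∃ λ ys → xs ↭ x ∷ ys
∈⇒↭∷ {x = x} x∈xs with ∈-∃++ x∈xs
... | ys , zs , refl = ys ++ zs , shift x ys zs

Unique-⊆-length⇒↭ : {xs ys : List A} → Unique xs → xs ⊆ ys → length ys ≡ length xs → ys ↭ xs
Unique-⊆-length⇒↭ {xs = []} {ys = []} _ _ _ = ↭-refl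
Unique-⊆-length⇒↭ {xs = x ∷ xs} {ys = ys} (x∉xs ∷ uniq) xs⊆ys len with ∈⇒↭∷ (xs⊆ys (here refl))
... | ys′ , ys↭ = ↭-trans ys↭ (prep x (Unique-⊆-length⇒↭ uniq xs⊆ys′ len′))
  where
  xs⊆ys′ : xs ⊆ ys′
  xs⊆ys′ {y} y∈xs with ∈-resp-↭ ys↭ (xs⊆ys (there y∈xs))
  ... | here refl = ⊥-elim (All.lookup x∉xs y∈xs refl)
  ... | there y∈ys′ = y∈ys′
  len′ : length ys′ ≡ length xs
  len′ = suc-injective (trans (sym (↭-length ys↭)) len)

-- Walks, balance and connectivity of multi-digraphs

module _ {W : Set} where

  WeightBalanced : List (W × W) → Set
  WeightBalanced as = (h : W → ℕ) → sumBy (h ∘ proj₁) as ≡ sumBy (h ∘ proj₂) as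

  ArcInvariant : (W → Bool) → List (W × W) → Set
  ArcInvariant S as = ∀ {a} → a ∈ as → S (proj₁ a) ≡ S (proj₂ a)

  -- Weak connectivity of the arcs (vertices without arcs are irrelevant),
  -- expressed as: every 2-colouring that no arc crosses is constant on them.
  Connected : List (W × W) → Set
  Connected as = (S : W → Bool) → ArcInvariant S as →
    ∀ {a b} → a ∈ as → b ∈ as → S (proj₁ a) ≡ S (proj₁ b)

  ClosedWalk : W → List (W × W) → Set
  ClosedWalk x as = WalkFromTo x as x

  walk-++ : {x y z : W} (as : List (W × W)) {bs : List (W × W)} →
    WalkFromTo x as y → WalkFromTo y bs z → WalkFromTo x (as ++ bs) z
  walk-++ []             refl          w = w
  walk-++ ((u , v) ∷ as) (x≡u , v⇝y) w = x≡u , walk-++ as v⇝y w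

  walk-++⁻ : {x z : W} (as : List (W × W)) {bs : List (W × W)} →
    WalkFromTo x (as ++ bs) z → ∃ λ y → WalkFromTo x as y × WalkFromTo y bs z
  walk-++⁻ []             w             = _ , refl , w
  walk-++⁻ ((u , v) ∷ as) (x≡u , v⇝z) with walk-++⁻ as v⇝z
  ... | y , v⇝y , y⇝z = y , (x≡u , v⇝y) , y⇝z

  walk-weight : (h : W → ℕ) {x y : W} (as : List (W × W)) → WalkFromTo x as y →
    sumBy (h ∘ proj₁) as + h y ≡ sumBy (h ∘ proj₂) as + h x
  walk-weight h []             refl          = refl
  walk-weight h ((u , v) ∷ as) (refl , v⇝y) =
    trans (+-assoc (h u) _ _) (trans (cong (h u +_) (walk-weight h as v⇝y)) (rearrange (h u) _ (h v)))
    where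
    rearrange : ∀ a b c → a + (b + c) ≡ c + b + a
    rearrange = solve-∀

  walk-colour : (S : W → Bool) {x y : W} (as : List (W × W)) → ArcInvariant S as →
    WalkFromTo x as y → ∀ {a} → a ∈ as → S (proj₁ a) ≡ S x
  walk-colour S ((u , v) ∷ as) inv (refl , v⇝y) (here refl) = refl
  walk-colour S ((u , v) ∷ as) inv (refl , v⇝y) (there a∈) =
    trans (walk-colour S as (inv ∘ there) v⇝y a∈) (sym (inv (here refl)))

  walk-targets : {x y : W} (as : List (W × W)) → WalkFromTo x as y →
    ∀ {a} → a ∈ as → proj₂ a ∈ map proj₁ as ⊎ proj₂ a ≡ y
  walk-targets ((u , v) ∷ [])             (_ , v≡y)        (here refl) = inj₂ v≡y
  walk-targets ((u , v) ∷ (u′ , v′) ∷ as) (_ , v≡u′ , _)  (here refl) = inj₁ (there (here v≡u′))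
  walk-targets ((u , v) ∷ as)             (_ , v⇝y)        (there a∈) with walk-targets as v⇝y a∈
  ... | inj₁ t∈ = inj₁ (there t∈)
  ... | inj₂ t≡y = inj₂ t≡y

  closedWalk-targets : {x : W} (as : List (W × W)) → ClosedWalk x as →
    ∀ {a} → a ∈ as → proj₂ a ∈ map proj₁ as
  closedWalk-targets as@((u , v) ∷ _) w@(x≡u , _) a∈ with walk-targets as w a∈
  ... | inj₁ t∈ = t∈
  ... | inj₂ refl = here x≡u

  WeightBalanced-resp-↭ : {as bs : List (W × W)} → as ↭ bs → WeightBalanced bs → WeightBalanced as
  WeightBalanced-resp-↭ p bal h = trans (sumBy-↭ _ p) (trans (bal h) (sym (sumBy-↭ _ p)))

  Eulerian⇒WeightBalanced : {as : List (W × W)} → Eulerian as → WeightBalanced as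
  Eulerian⇒WeightBalanced (w , w↭as , inj₁ refl)      = WeightBalanced-resp-↭ (↭-sym w↭as) (λ h → refl)
  Eulerian⇒WeightBalanced (w , w↭as , inj₂ (x , x⇝x)) =
    WeightBalanced-resp-↭ (↭-sym w↭as) (λ h → +-cancelʳ-≡ _ _ _ (walk-weight h w x⇝x))

  Eulerian⇒Connected : {as : List (W × W)} → Eulerian as → Connected as
  Eulerian⇒Connected (w , w↭as , inj₁ refl) S inv a∈ b∈ with () ← ∈-resp-↭ (↭-sym w↭as) a∈
  Eulerian⇒Connected (w , w↭as , inj₂ (x , x⇝x)) S inv a∈ b∈ = trans (onWalk a∈) (sym (onWalk b∈))
    where
    onWalk : ∀ {a} → a ∈ _ → S (proj₁ a) ≡ S x
    onWalk a∈ = walk-colour S w (inv ∘ ∈-resp-↭ w↭as) x⇝x (∈-resp-↭ (↭-sym w↭as) a∈)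

-- Euler's theorem

module Indicator {W : Set} (_≟_ : DecidableEquality W) where

  𝟙[_] : W → W → ℕ
  𝟙[ x ] v with v ≟ x
  ... | yes _ = 1
  ... | no  _ = 0

  𝟙-refl : ∀ x → 𝟙[ x ] x ≡ 1
  𝟙-refl x with x ≟ x
  ... | yes _   = refl
  ... | no  x≢x = ⊥-elim (x≢x refl)

  𝟙-≢ : ∀ {x v} → v ≢ x → 𝟙[ x ] v ≡ 0
  𝟙-≢ {x} {v} v≢x with v ≟ x
  ... | yes v≡x = ⊥-elim (v≢x v≡x)
  ... | no  _   = refl

module EulerTheorem {W : Set} (_≟_ : DecidableEquality W) where

  open import Data.List.Membership.DecPropositional _≟_ using (_∈?_)
  open Indicator _≟_

  leaving-arc : (z : W) (R : List (W × W)) → sumBy (𝟙[ z ] ∘ proj₁) R ≢ 0 → ∃ λ w → (z , w) ∈ R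
  leaving-arc z []            out≢0 = ⊥-elim (out≢0 refl)
  leaving-arc z ((u , v) ∷ R) out≢0 with u ≟ z
  ... | yes refl = v , here refl
  ... | no  _    = let w , zw∈R = leaving-arc z R out≢0 in w , there zw∈R

  entered⇒left : {R : List (W × W)} → WeightBalanced R → ∀ {u y} → (u , y) ∈ R → ∃ λ w → (y , w) ∈ R
  entered⇒left {R} bal {y = y} uy∈R = leaving-arc y R λ out≡0 →
    ∈-sumBy-≢0 (𝟙[ y ] ∘ proj₂) uy∈R (λ 𝟙≡0 → 1+n≢0 (trans (sym (𝟙-refl y)) 𝟙≡0)) (trans (sym (bal 𝟙[ y ])) out≡0)

  source-of-imbalance : (R : List (W × W)) {y z : W} → z ≢ y → WeightBalanced ((y , z) ∷ R) →
    sumBy (𝟙[ z ] ∘ proj₁) R ≢ 0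
  source-of-imbalance R {y} {z} z≢y bal out≡0 = 0≢1+n (begin
    0                                            ≡⟨ sym (cong₂ _+_ (𝟙-≢ (z≢y ∘ sym)) out≡0) ⟩
    𝟙[ z ] y + sumBy (𝟙[ z ] ∘ proj₁) R         ≡⟨ bal 𝟙[ z ] ⟩
    𝟙[ z ] z + sumBy (𝟙[ z ] ∘ proj₂) R         ≡⟨ cong (_+ sumBy (𝟙[ z ] ∘ proj₂) R) (𝟙-refl z) ⟩
    suc (sumBy (𝟙[ z ] ∘ proj₂) R)               ∎)
    where open ≡-Reasoning

  Trail : List (W × W) → W → W → Set
  Trail R z y = Σ (List (W × W)) λ P → Σ (List (W × W)) λ R′ →
    WalkFromTo z P y × P ++ R′ ↭ R × WeightBalanced R′

  -- WeightBalanced ((y , z) ∷ R): R is balanced up to one missing arc y → z.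
  trail : (R : List (W × W)) {y z : W} → WeightBalanced ((y , z) ∷ R) → Trail R z y
  trail R = go R (<-wellFounded (length R))
    where
    go : (R : List (W × W)) → Acc _<_ (length R) → ∀ {y z} → WeightBalanced ((y , z) ∷ R) → Trail R z y
    go R _ {y} {z} bal with z ≟ y
    ... | yes refl = [] , R , refl , ↭-refl , λ h → +-cancelˡ-≡ (h z) _ _ (bal h)
    go R (acc rec) {y} {z} bal | no z≢y with leaving-arc z R (source-of-imbalance R z≢y bal)
    ... | w , zw∈R with ∈⇒↭∷ zw∈R
    ... | R₁ , R↭ with go R₁ (rec (≤-reflexive (sym (↭-length R↭)))) bal₁
      where
      bal₁ : WeightBalanced ((y , w) ∷ R₁)
      bal₁ h = +-cancelˡ-≡ (h z) _ _ (begin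
        h z + (h y + sumBy (h ∘ proj₁) R₁)   ≡⟨ x∙yz≈y∙xz (h z) (h y) _ ⟩
        h y + sumBy (h ∘ proj₁) ((z , w) ∷ R₁)     ≡⟨ cong (h y +_) (sumBy-↭ _ (↭-sym R↭)) ⟩
        h y + sumBy (h ∘ proj₁) R            ≡⟨ bal h ⟩
        h z + sumBy (h ∘ proj₂) R            ≡⟨ cong (h z +_) (sumBy-↭ _ R↭) ⟩
        h z + (h w + sumBy (h ∘ proj₂) R₁)   ∎)
        where open ≡-Reasoning
    ... | P , R′ , w⇝y , P++R′↭R₁ , bal′ =
      (z , w) ∷ P , R′ , (refl , w⇝y) , ↭-trans (prep _ P++R′↭R₁) (↭-sym R↭) , bal′

  closed-trail : {R : List (W × W)} {y z : W} → WeightBalanced R → (y , z) ∈ R →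
    Σ (List (W × W)) λ P → Σ (List (W × W)) λ R′ →
      WalkFromTo z P y × (y , z) ∷ P ++ R′ ↭ R × WeightBalanced R′
  closed-trail bal yz∈R with ∈⇒↭∷ yz∈R
  ... | R₁ , R↭ with trail R₁ (WeightBalanced-resp-↭ (↭-sym R↭) bal)
  ... | P , R′ , z⇝y , P++R′↭R₁ , bal′ = P , R′ , z⇝y , ↭-trans (prep _ P++R′↭R₁) (↭-sym R↭) , bal′

  splice : {b y : W} (C₀ C : List (W × W)) → ClosedWalk b C₀ → y ∈ map proj₁ C₀ → ClosedWalk y C →
    ∃ λ C₁ → ClosedWalk b C₁ × C₁ ↭ C₀ ++ C
  splice C₀ C b⇝b y∈ y⇝y with ∈-map⁻ proj₁ y∈
  ... | (y , v) , yv∈C₀ , refl with ∈-∃++ yv∈C₀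
  ... | C₁ , C₂ , refl with walk-++⁻ C₁ b⇝b
  ... | _ , b⇝y , (refl , v⇝b) =
    C₁ ++ C ++ (y , v) ∷ C₂ ,
    walk-++ C₁ b⇝y (walk-++ C y⇝y (refl , v⇝b)) ,
    ↭-trans (++⁺ˡ C₁ (++-comm C ((y , v) ∷ C₂))) (↭-reflexive (sym (++-assoc C₁ ((y , v) ∷ C₂) C)))

  record PartialTour (A : List (W × W)) : Set where
    constructor tour
    field
      base        : W
      walk rest   : List (W × W)
      closed      : ClosedWalk base walk
      base∈walk   : base ∈ map proj₁ walk
      partition   : walk ++ rest ↭ A
      balanced    : WeightBalanced rest
  open PartialTour

  -- If no arc of the remainder touched the tour, lying on the tour would be
  -- an arc-invariant colouring separating the tour from the remainder.
  touching-arc : {A : List (W × W)} → Connected A → (T : PartialTour A) → ∀ {r} → r ∈ rest T →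
    ∃₂ λ y z → y ∈ map proj₁ (walk T) × (y , z) ∈ rest T
  touching-arc {A} conn T {r} r∈rest with any? touches? (rest T)
    where
    OnTour : W → Set
    OnTour v = v ∈ map proj₁ (walk T)
    Touches : W × W → Set
    Touches a = OnTour (proj₁ a) ⊎ OnTour (proj₂ a)
    touches? : (a : W × W) → Dec (Touches a)
    touches? a = (proj₁ a ∈? map proj₁ (walk T)) ⊎-dec (proj₂ a ∈? map proj₁ (walk T))
  ... | yes touched with find touched
  ... | (y , z) , yz∈ , inj₁ y∈ = y , z , y∈ , yz∈
  ... | (y , z) , yz∈ , inj₂ z∈ = let w , zw∈ = entered⇒left (balanced T) yz∈ in z , w , z∈ , zw∈
  touching-arc {A} conn T {r} r∈rest | no untouched = contradiction true≡false λ ()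
    where
    onTour? : (v : W) → Dec (v ∈ map proj₁ (walk T))
    onTour? v = v ∈? map proj₁ (walk T)
    S : W → Bool
    S v = does (onTour? v)
    invariant : ArcInvariant S A
    invariant a∈A with ∈-++⁻ (walk T) (∈-resp-↭ (↭-sym (partition T)) a∈A)
    ... | inj₁ a∈walk = trans (dec-true (onTour? _) (∈-map⁺ proj₁ a∈walk))
                             (sym (dec-true (onTour? _) (closedWalk-targets (walk T) (closed T) a∈walk)))
    ... | inj₂ a∈rest = trans (dec-false (onTour? _) (untouched ∘ lose a∈rest ∘ inj₁))
                             (sym (dec-false (onTour? _) (untouched ∘ lose a∈rest ∘ inj₂)))
    true≡false : true ≡ false
    true≡false = let (a , a∈walk , _) = ∈-map⁻ proj₁ (base∈walk T) in begin
      true           ≡⟨ dec-true (onTour? _) (∈-map⁺ proj₁ a∈walk) ⟨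
      S (proj₁ a)    ≡⟨ conn S invariant (∈-resp-↭ (partition T) (∈-++⁺ˡ a∈walk))
                                         (∈-resp-↭ (partition T) (∈-++⁺ʳ (walk T) r∈rest)) ⟩
      S (proj₁ r)    ≡⟨ dec-false (onTour? _) (untouched ∘ lose r∈rest ∘ inj₁) ⟩
      false          ∎
      where open ≡-Reasoning

  grow : {A : List (W × W)} → Connected A → (T : PartialTour A) → Acc _<_ (length (rest T)) → Eulerian A
  grow conn (tour b C [] b⇝b _ C↭A _) _ = C , ↭-trans (↭-reflexive (sym (++-identityʳ C))) C↭A , inj₂ (b , b⇝b)
  grow {A} conn T@(tour b C R@(_ ∷ _) b⇝b b∈C C++R↭A bal) (acc rec)
    with touching-arc conn T (here refl)
  ... | y , z , y∈C , yz∈R with closed-trail bal yz∈R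
  ... | P , R′ , z⇝y , loop++R′↭R , bal′ with splice C ((y , z) ∷ P) b⇝b y∈C (refl , z⇝y)
  ... | C′ , b⇝b′ , C′↭ =
    grow conn (tour b C′ R′ b⇝b′ b∈C′ partition′ bal′) (rec shorter)
    where
    b∈C′ : b ∈ map proj₁ C′
    b∈C′ = ∈-resp-↭ (map⁺ proj₁ (↭-sym C′↭)) (subst (b ∈_) (sym (map-++ proj₁ C _)) (∈-++⁺ˡ b∈C))
    partition′ : C′ ++ R′ ↭ A
    partition′ = begin
      C′ ++ R′                     ↭⟨ ++⁺ʳ R′ C′↭ ⟩
      (C ++ (y , z) ∷ P) ++ R′     ≡⟨ ++-assoc C _ R′ ⟩
      C ++ (y , z) ∷ P ++ R′       ↭⟨ ++⁺ˡ C loop++R′↭R ⟩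
      C ++ R                       ↭⟨ C++R↭A ⟩
      A                            ∎
      where open PermutationReasoning
    shorter : length R′ < length R
    shorter = begin-strict
      length R′                    <⟨ s≤s (m≤n+m (length R′) (length P)) ⟩
      suc (length P + length R′)   ≡⟨ cong suc (sym (length-++ P)) ⟩
      length ((y , z) ∷ P ++ R′)   ≡⟨ ↭-length loop++R′↭R ⟩
      length R                     ∎
      where open ≤-Reasoning

  euler : {A : List (W × W)} → WeightBalanced A → Connected A → Eulerian A
  euler {[]}            _   _    = [] , ↭-refl , inj₁ refl
  euler {(y , z) ∷ A′} bal conn with closed-trail bal (here refl)
  ... | P , R′ , z⇝y , loop++R′↭A , bal′ =
    grow conn (tour y ((y , z) ∷ P) R′ (refl , z⇝y) (here refl) loop++R′↭A bal′) (<-wellFounded _)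

-- The hypergraph Ĝ^(k) and the digraphs D_f and D*

balance-arithmetic : ∀ c h i x t → (2 + c) * h ≡ t → (2 + c) * x ≡ c * t → i + h + x ≡ t → i ≡ h
balance-arithmetic c h i x t h≡ x≡ i+h+x≡t = *-cancelˡ-≡ i h (2 + c) (trans (+-cancelʳ-≡ (t + c * t) _ _ (begin
  (2 + c) * i + (t + c * t)                ≡⟨ cong ((2 + c) * i +_) (cong₂ _+_ (sym h≡) (sym x≡)) ⟩
  (2 + c) * i + ((2 + c) * h + (2 + c) * x) ≡⟨ distribute (2 + c) i h x ⟩
  (2 + c) * (i + h + x)                    ≡⟨ cong ((2 + c) *_) i+h+x≡t ⟩
  (2 + c) * t                              ≡⟨ expand c t ⟩
  t + (t + c * t)                          ∎)) (sym h≡))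
  where
  open ≡-Reasoning
  distribute : ∀ n a b d → n * a + (n * b + n * d) ≡ n * (a + b + d)
  distribute = solve-∀
  expand : ∀ c t → (2 + c) * t ≡ t + (t + c * t)
  expand = solve-∀

module Star (G : SimpleGraph) (c : ℕ) where

  open SimpleGraph G
  open Indicator (_≟ᶠ_ {length edges})

  k : ℕ
  k = 2 + c

  Vᵏ : Set
  Vᵏ = V G k

  end₁ end₂ : Edge G k → Fin m
  end₁ e = proj₁ (lookup edges e)
  end₂ e = proj₂ (lookup edges e)

  end₁≢end₂ : ∀ e → end₁ e ≢ end₂ e
  end₁≢end₂ e eq = <-irrefl (cong Fin.toℕ eq) (All.lookup ordered (∈-lookup e))

  core : Edge G k → Fin c → Vᵏ
  core e t = inj₂ (e , t)

  hyperedge : Edge G k → List Vᵏ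
  hyperedge e = inj₁ (end₁ e) ∷ inj₁ (end₂ e) ∷ tabulate (core e)

  inj₁-injective : ∀ {u v : Fin m} → inj₁ {B = Edge G k × Fin c} u ≡ inj₁ v → u ≡ v
  inj₁-injective refl = refl

  hyperedge-unique : ∀ e → Unique (hyperedge e)
  hyperedge-unique e = (end₁≢end₂ e ∘ inj₁-injective ∷ noCore) ∷ noCore ∷ Unique.tabulate⁺ core-injective
    where
    core-injective : ∀ {s t} → core e s ≡ core e t → s ≡ t
    core-injective refl = refl
    noCore : ∀ {u} → All (inj₁ u ≢_) (tabulate (core e))
    noCore = All.tabulate λ v∈ → let _ , v≡core = ∈-tabulate⁻ v∈ in λ u≡v → case trans u≡v v≡core of λ ()

  ∈⇒InHyperedge : ∀ {e v} → v ∈ hyperedge e → InHyperedge G k e v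
  ∈⇒InHyperedge (here refl)         = inj₁ refl
  ∈⇒InHyperedge (there (here refl)) = inj₂ (inj₁ refl)
  ∈⇒InHyperedge (there (there v∈)) = inj₂ (inj₂ (∈-tabulate⁻ v∈))

  core-InHyperedge : ∀ {e e′ t} → InHyperedge G k e (core e′ t) → e′ ≡ e
  core-InHyperedge (inj₂ (inj₂ (_ , refl))) = refl

  head∈ : ∀ {s α e} → SpansHyperedge G k (s , α) e → InHyperedge G k e s
  head∈ sp = Equivalence.to (sp _) (inj₁ refl)

  entry-↭-hyperedge : ∀ {s α e} → SpansHyperedge G k (s , α) e → s ∷ toList α ↭ hyperedge e
  entry-↭-hyperedge {s} {α} {e} sp = Unique-⊆-length⇒↭ (hyperedge-unique e) hyperedge⊆ sameLength
    where
    hyperedge⊆ : hyperedge e ⊆ s ∷ toList α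
    hyperedge⊆ {v} v∈ with Equivalence.from (sp v) (∈⇒InHyperedge v∈)
    ... | inj₁ refl = here refl
    ... | inj₂ v∈α  = there (∈-toList⁺ v∈α)
    sameLength : suc (length (toList α)) ≡ suc (suc (length (tabulate (core e))))
    sameLength = cong suc (trans (length-toList α) (sym (cong suc (length-tabulate (core e)))))

  sumBy-entry : ∀ {s α e} → SpansHyperedge G k (s , α) e → (w : Vᵏ → ℕ) {v : ℕ} → (∀ t → w (core e t) ≡ v) →
    w s + sumBy w (toList α) ≡ w (inj₁ (end₁ e)) + (w (inj₁ (end₂ e)) + c * v)
  sumBy-entry {e = e} sp w w∘core≡v = trans (sumBy-↭ w (entry-↭-hyperedge sp))
    (cong (λ x → w (inj₁ (end₁ e)) + (w (inj₁ (end₂ e)) + x)) (sumBy-tabulate-const w (core e) w∘core≡v))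

  Spans : Entry G k → Set
  Spans E = ∃ (SpansHyperedge G k E)

  arcsOf : List (Entry G k) → List (Vᵏ × Vᵏ)
  arcsOf = concatMap (entryArcs G k)

  starOf : List (Vᵏ × Vᵏ) → List (Fin m × Fin m)
  starOf = concatMap (restrict G k)

  tailWeight : (Vᵏ → ℕ) → Entry G k → ℕ
  tailWeight w (_ , α) = sumBy w (toList α)

  sumBy-arcsOf : (F : Vᵏ × Vᵏ → ℕ) (Es : List (Entry G k)) →
    sumBy F (arcsOf Es) ≡ sumBy (λ { (s , α) → sumBy (λ v → F (s , v)) (toList α) }) Es
  sumBy-arcsOf F Es = trans (sumBy-concatMap F (entryArcs G k) Es) (sumBy-cong (λ { (s , α) → sumBy-map F _ (toList α) }) Es)

  heads-weight : (Es : List (Entry G k)) → WeightBalanced (arcsOf Es) →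
    (w : Vᵏ → ℕ) → suc c * sumBy (w ∘ proj₁) Es ≡ sumBy (tailWeight w) Es
  heads-weight Es bal w = begin
    suc c * sumBy (w ∘ proj₁) Es                       ≡⟨ sym (sumBy-*ˡ (suc c) (w ∘ proj₁) Es) ⟩
    sumBy (λ E → suc c * w (proj₁ E)) Es                ≡⟨ sumBy-cong outOfHead Es ⟨
    sumBy (λ { (s , α) → sumBy (λ _ → w s) (toList α) }) Es ≡⟨ sumBy-arcsOf (w ∘ proj₁) Es ⟨
    sumBy (w ∘ proj₁) (arcsOf Es)                      ≡⟨ bal w ⟩
    sumBy (w ∘ proj₂) (arcsOf Es)                      ≡⟨ sumBy-arcsOf (w ∘ proj₂) Es ⟩
    sumBy (tailWeight w) Es                            ∎
    where
    open ≡-Reasoning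
    outOfHead : (E : Entry G k) → sumBy (λ _ → w (proj₁ E)) (toList (proj₂ E)) ≡ suc c * w (proj₁ E)
    outOfHead (s , α) = trans (sumBy-const (w s) (toList α)) (cong (_* w s) (length-toList α))

  lift : (Fin m → ℕ) → Vᵏ → ℕ
  lift h (inj₁ u) = h u
  lift h (inj₂ _) = 0

  isOriginal : Vᵏ → ℕ
  isOriginal = lift (λ _ → 1)

  coreWeight : (Fin m → ℕ) → Vᵏ → ℕ
  coreWeight h (inj₁ _)       = 0
  coreWeight h (inj₂ (e , _)) = h (end₁ e) + h (end₂ e)

  restrict-sources : (h : Fin m → ℕ) (a : Vᵏ × Vᵏ) →
    sumBy (h ∘ proj₁) (restrict G k a) ≡ lift h (proj₁ a) * isOriginal (proj₂ a)
  restrict-sources h (inj₁ u , inj₁ _) = trans (+-identityʳ (h u)) (sym (*-identityʳ (h u)))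
  restrict-sources h (inj₁ u , inj₂ _) = sym (*-zeroʳ (h u))
  restrict-sources h (inj₂ _ , _)      = refl

  restrict-targets : (h : Fin m → ℕ) (a : Vᵏ × Vᵏ) →
    sumBy (h ∘ proj₂) (restrict G k a) ≡ isOriginal (proj₁ a) * lift h (proj₂ a)
  restrict-targets h (inj₁ _ , inj₁ _) = refl
  restrict-targets h (inj₁ _ , inj₂ _) = refl
  restrict-targets h (inj₂ _ , _)      = refl

  sumBy-starOf : (g : Fin m × Fin m → ℕ) (F : Vᵏ × Vᵏ → ℕ) → (∀ a → sumBy g (restrict G k a) ≡ F a) →
    (Es : List (Entry G k)) → sumBy g (starOf (arcsOf Es)) ≡ sumBy (λ { (s , α) → sumBy (λ v → F (s , v)) (toList α) }) Es
  sumBy-starOf g F restrict≡F Es =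
    trans (sumBy-concatMap g (restrict G k) (arcsOf Es)) (trans (sumBy-cong restrict≡F (arcsOf Es)) (sumBy-arcsOf F Es))

  star-sources : (h : Fin m → ℕ) (Es : List (Entry G k)) →
    sumBy (h ∘ proj₁) (starOf (arcsOf Es)) ≡ sumBy (λ E → lift h (proj₁ E) * tailWeight isOriginal E) Es
  star-sources h Es = trans (sumBy-starOf _ _ (restrict-sources h) Es)
    (sumBy-cong (λ { (s , α) → sumBy-*ˡ (lift h s) isOriginal (toList α) }) Es)

  star-targets : (h : Fin m → ℕ) (Es : List (Entry G k)) →
    sumBy (h ∘ proj₂) (starOf (arcsOf Es)) ≡ sumBy (λ E → isOriginal (proj₁ E) * tailWeight (lift h) E) Es
  star-targets h Es = trans (sumBy-starOf _ _ (restrict-targets h) Es)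
    (sumBy-cong (λ { (s , α) → sumBy-*ˡ (isOriginal s) (lift h) (toList α) }) Es)

  sumBy-entry-lift : ∀ {s α e} → SpansHyperedge G k (s , α) e → (h : Fin m → ℕ) →
    lift h s + tailWeight (lift h) (s , α) ≡ h (end₁ e) + h (end₂ e)
  sumBy-entry-lift {e = e} sp h = trans (sumBy-entry sp (lift h) (λ _ → refl))
    (cong (h (end₁ e) +_) (trans (cong (h (end₂ e) +_) (*-zeroʳ c)) (+-identityʳ _)))

  head-out : (h : Fin m → ℕ) (E : Entry G k) → Spans E →
    lift h (proj₁ E) * tailWeight isOriginal E ≡ lift h (proj₁ E)
  head-out h (inj₁ u , α) (_ , sp) = trans (cong (h u *_) (+-cancelˡ-≡ 1 _ _ (sumBy-entry-lift sp (λ _ → 1)))) (*-identityʳ (h u))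
  head-out h (inj₂ _ , α) _        = refl

  head-in : (h : Fin m → ℕ) (E : Entry G k) → Spans E →
    isOriginal (proj₁ E) * tailWeight (lift h) E + lift h (proj₁ E) + coreWeight h (proj₁ E)
      ≡ lift h (proj₁ E) + tailWeight (lift h) E
  head-in h (inj₁ u , α) _ = rearrange (tailWeight (lift h) (inj₁ u , α)) (h u)
    where
    rearrange : ∀ t a → 1 * t + a + 0 ≡ a + t
    rearrange = solve-∀
  head-in h (inj₂ (e′ , _) , α) (e , sp) with refl ← core-InHyperedge (head∈ sp) = sym (sumBy-entry-lift sp h)

  core-balance : (h : Fin m → ℕ) (E : Entry G k) → Spans E →
    coreWeight h (proj₁ E) + tailWeight (coreWeight h) E ≡ c * (lift h (proj₁ E) + tailWeight (lift h) E)
  core-balance h (s , α) (e , sp) = trans (sumBy-entry sp (coreWeight h) (λ _ → refl)) (cong (c *_) (sym (sumBy-entry-lift sp h)))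

  star-weightBalanced : (Es : List (Entry G k)) → All Spans Es → WeightBalanced (arcsOf Es) →
    WeightBalanced (starOf (arcsOf Es))
  star-weightBalanced Es spans bal h = begin
    sumBy (h ∘ proj₁) (starOf (arcsOf Es))  ≡⟨ star-sources h Es ⟩
    sumBy (λ E → lift h (proj₁ E) * tailWeight isOriginal E) Es
                                            ≡⟨ sumBy-cong-local (All.map (head-out h _) spans) ⟩
    Heads                                   ≡⟨ balance-arithmetic c Heads Ins Cores Total
                                                 heads-weight-total cores-weight-total ins-heads-cores ⟨
    Ins                                     ≡⟨ star-targets h Es ⟨
    sumBy (h ∘ proj₂) (starOf (arcsOf Es))  ∎
    where
    open ≡-Reasoning
    Heads Ins Cores Total : ℕ
    Heads = sumBy (lift h ∘ proj₁) Es
    Ins   = sumBy (λ E → isOriginal (proj₁ E) * tailWeight (lift h) E) Es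
    Cores = sumBy (coreWeight h ∘ proj₁) Es
    Total = sumBy (λ E → lift h (proj₁ E) + tailWeight (lift h) E) Es
    heads-weight-total : (2 + c) * Heads ≡ Total
    heads-weight-total = sym (trans (sumBy-+ (lift h ∘ proj₁) (tailWeight (lift h)) Es)
      (cong (Heads +_) (sym (heads-weight Es bal (lift h)))))
    cores-weight-total : (2 + c) * Cores ≡ c * Total
    cores-weight-total = begin
      (2 + c) * Cores                    ≡⟨ cong (Cores +_) (heads-weight Es bal (coreWeight h)) ⟩
      Cores + sumBy (tailWeight (coreWeight h)) Es
                                         ≡⟨ sumBy-+ (coreWeight h ∘ proj₁) (tailWeight (coreWeight h)) Es ⟨
      sumBy (λ E → coreWeight h (proj₁ E) + tailWeight (coreWeight h) E) Es
                                         ≡⟨ sumBy-cong-local (All.map (core-balance h _) spans) ⟩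
      sumBy (λ E → c * (lift h (proj₁ E) + tailWeight (lift h) E)) Es
                                         ≡⟨ sumBy-*ˡ c _ Es ⟩
      c * Total                          ∎
    ins-heads-cores : Ins + Heads + Cores ≡ Total
    ins-heads-cores = begin
      Ins + Heads + Cores                ≡⟨ cong (_+ Cores) (sumBy-+ _ (lift h ∘ proj₁) Es) ⟨
      sumBy (λ E → isOriginal (proj₁ E) * tailWeight (lift h) E + lift h (proj₁ E)) Es + Cores
                                         ≡⟨ sumBy-+ _ (coreWeight h ∘ proj₁) Es ⟨
      sumBy (λ E → isOriginal (proj₁ E) * tailWeight (lift h) E + lift h (proj₁ E) + coreWeight h (proj₁ E)) Es
                                         ≡⟨ sumBy-cong-local (All.map (head-in h _) spans) ⟩
      Total                              ∎

  arcsOf⁺ : ∀ {E Es v} → E ∈ Es → v ∈ toList (proj₂ E) → (proj₁ E , v) ∈ arcsOf Es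
  arcsOf⁺ E∈ v∈ = ∈-concatMap⁺ (entryArcs G k) (lose E∈ (∈-map⁺ _ v∈))

  arcsOf⁻ : ∀ {a Es} → a ∈ arcsOf Es → ∃₂ λ E v → E ∈ Es × v ∈ toList (proj₂ E) × a ≡ (proj₁ E , v)
  arcsOf⁻ {Es = Es} a∈ with find (∈-concatMap⁻ (entryArcs G k) {xs = Es} a∈)
  ... | E , E∈ , a∈E with ∈-map⁻ _ a∈E
  ... | v , v∈ , refl = E , v , E∈ , v∈ , refl

  starOf⁺ : ∀ {u v D} → (inj₁ u , inj₁ v) ∈ D → (u , v) ∈ starOf D
  starOf⁺ uv∈ = ∈-concatMap⁺ (restrict G k) (lose uv∈ (here refl))

  starOf⁻ : ∀ {a} (D : List (Vᵏ × Vᵏ)) → a ∈ starOf D → (inj₁ (proj₁ a) , inj₁ (proj₂ a)) ∈ D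
  starOf⁻ ((inj₁ _ , inj₁ _) ∷ D) (here refl) = here refl
  starOf⁻ ((inj₁ _ , inj₁ _) ∷ D) (there a∈)  = there (starOf⁻ D a∈)
  starOf⁻ ((inj₁ _ , inj₂ _) ∷ D) a∈          = there (starOf⁻ D a∈)
  starOf⁻ ((inj₂ _ , _)      ∷ D) a∈          = there (starOf⁻ D a∈)

  StarEdge : Edge G k → List (Fin m × Fin m) → Set
  StarEdge e D* = (end₁ e , end₂ e) ∈ D* ⊎ (end₂ e , end₁ e) ∈ D*

  starEdge? : ∀ e D* → Dec (StarEdge e D*)
  starEdge? e D* = ((end₁ e , end₂ e) ∈²? D*) ⊎-dec ((end₂ e , end₁ e) ∈²? D*)
    where open import Data.List.Membership.DecPropositional (≡-dec (_≟ᶠ_ {m}) _≟ᶠ_) renaming (_∈?_ to _∈²?_)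

  tail∈ : ∀ {s α e v} → SpansHyperedge G k (s , α) e → InHyperedge G k e v → v ≢ s → v ∈ toList α
  tail∈ {v = v} sp v∈e v≢s with Equivalence.from (sp v) v∈e
  ... | inj₁ v≡s = ⊥-elim (v≢s v≡s)
  ... | inj₂ v∈α = ∈-toList⁺ v∈α

  endpoint-head⇒StarEdge : ∀ {u α e Es} → (inj₁ u , α) ∈ Es → SpansHyperedge G k (inj₁ u , α) e →
    StarEdge e (starOf (arcsOf Es))
  endpoint-head⇒StarEdge {e = e} E∈ sp with head∈ sp
  ... | inj₁ refl        = inj₁ (starOf⁺ (arcsOf⁺ E∈ (tail∈ sp (inj₂ (inj₁ refl)) (end₁≢end₂ e ∘ sym ∘ inj₁-injective))))
  ... | inj₂ (inj₁ refl) = inj₂ (starOf⁺ (arcsOf⁺ E∈ (tail∈ sp (inj₁ refl) (end₁≢end₂ e ∘ inj₁-injective))))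

  coreIndicator : Edge G k → Vᵏ → ℕ
  coreIndicator e (inj₁ _)        = 0
  coreIndicator e (inj₂ (e′ , _)) = 𝟙[ e ] e′

  head-in-core : ∀ {e e′ E Es} → ¬ StarEdge e (starOf (arcsOf Es)) → E ∈ Es → SpansHyperedge G k E e′ →
    coreIndicator e (proj₁ E) ≡ 𝟙[ e ] e′
  head-in-core {E = inj₂ _ , _}        _       _  sp with refl ← core-InHyperedge (head∈ sp) = refl
  head-in-core {e} {e′} {inj₁ _ , _} noEdge E∈ sp with e′ ≟ᶠ e
  ... | yes refl = ⊥-elim (noEdge (endpoint-head⇒StarEdge E∈ sp))
  ... | no _     = refl

  edge-in-star : (Es : List (Entry G k)) → All Spans Es → WeightBalanced (arcsOf Es) →
    ∀ {E e} → E ∈ Es → SpansHyperedge G k E e → StarEdge e (starOf (arcsOf Es))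
  edge-in-star Es spans bal {E} {e} E∈ sp with starEdge? e (starOf (arcsOf Es))
  ... | yes edge  = edge
  ... | no noEdge = ⊥-elim (∈-sumBy-≢0 (coreIndicator e ∘ proj₁) E∈ E-in-core heads≡0)
    where
    Heads : ℕ
    Heads = sumBy (coreIndicator e ∘ proj₁) Es
    E-in-core : coreIndicator e (proj₁ E) ≢ 0
    E-in-core E-out = 1+n≢0 (trans (sym (𝟙-refl e)) (trans (sym (head-in-core noEdge E∈ sp)) E-out))
    per-entry : ∀ {E′} → E′ ∈ Es →
      coreIndicator e (proj₁ E′) + tailWeight (coreIndicator e) E′ ≡ c * coreIndicator e (proj₁ E′)
    per-entry {s , α} E′∈ = let e′ , sp′ = All.lookup spans E′∈ in
      trans (sumBy-entry sp′ (coreIndicator e) (λ _ → refl)) (cong (c *_) (sym (head-in-core noEdge E′∈ sp′)))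
    heads≡0 : Heads ≡ 0
    heads≡0 = m+n≡0⇒m≡0 Heads (+-cancelʳ-≡ (c * Heads) (Heads + Heads) 0 (begin
      Heads + Heads + c * Heads              ≡⟨ +-assoc Heads Heads _ ⟩
      Heads + suc c * Heads                  ≡⟨ cong (Heads +_) (heads-weight Es bal (coreIndicator e)) ⟩
      Heads + sumBy (tailWeight (coreIndicator e)) Es
                                             ≡⟨ sumBy-+ (coreIndicator e ∘ proj₁) _ Es ⟨
      sumBy (λ E′ → coreIndicator e (proj₁ E′) + tailWeight (coreIndicator e) E′) Es
                                             ≡⟨ sumBy-cong-local (All.tabulate per-entry) ⟩
      sumBy (λ E′ → c * coreIndicator e (proj₁ E′)) Es
                                             ≡⟨ sumBy-*ˡ c _ Es ⟩
      c * Heads                              ∎))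
      where open ≡-Reasoning

  -- A colouring of the original vertices extends to the core vertices of e by
  -- the colour of end₁ e; every arc of D then stays inside one hyperedge.
  star-connected : (Es : List (Entry G k)) → All Spans Es → (∀ e → StarEdge e (starOf (arcsOf Es))) →
    Connected (arcsOf Es) → Connected (starOf (arcsOf Es))
  star-connected Es spans starEdges conn S inv a∈ b∈ =
    conn S⁺ inv⁺ (starOf⁻ (arcsOf Es) a∈) (starOf⁻ (arcsOf Es) b∈)
    where
    S⁺ : Vᵏ → Bool
    S⁺ (inj₁ u)       = S u
    S⁺ (inj₂ (e , _)) = S (end₁ e)
    ends-agree : ∀ e → S (end₁ e) ≡ S (end₂ e)
    ends-agree e with starEdges e
    ... | inj₁ e∈ = inv e∈
    ... | inj₂ e∈ = sym (inv e∈)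
    S⁺-on-hyperedge : ∀ {e v} → InHyperedge G k e v → S⁺ v ≡ S (end₁ e)
    S⁺-on-hyperedge (inj₁ refl)              = refl
    S⁺-on-hyperedge {e} (inj₂ (inj₁ refl))   = sym (ends-agree e)
    S⁺-on-hyperedge (inj₂ (inj₂ (_ , refl))) = refl
    inv⁺ : ArcInvariant S⁺ (arcsOf Es)
    inv⁺ a∈ with arcsOf⁻ a∈
    ... | E , v , E∈ , v∈ , refl = let e , sp = All.lookup spans E∈ in
      trans (S⁺-on-hyperedge (head∈ sp)) (sym (S⁺-on-hyperedge (Equivalence.to (sp v) (inj₂ (∈-toList⁻ v∈)))))

lemma4p2 : (k : ℕ) → 3 ≤ k → (G : SimpleGraph) → (n : ℕ) → (lab : V G k ⤖ Fin n)
    → (d : ℕ) → 1 ≤ d → (f : Vec (Entry G k) d) → InF G k n lab d f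
    → Eulerian (arcsD G k f) → Eulerian (arcsDstar G k f)
lemma4p2 .(2 + c) (s≤s (s≤s {n = c} _)) G _ _ _ _ f (spansHyperedge , _ , covered) eulerian =
  euler _≟ᶠ_ (star-weightBalanced Es spans balanced) (star-connected Es spans starEdges (Eulerian⇒Connected eulerian))
  where
  open Star G c
  open EulerTheorem using (euler)
  Es : List (Entry G (2 + c))
  Es = toList f
  spans : All Spans Es
  spans = VecAll.toList⁺ (VecAll.lookup⁻ spansHyperedge)
  balanced : WeightBalanced (arcsOf Es)
  balanced = Eulerian⇒WeightBalanced eulerian
  starEdges : ∀ e → StarEdge e (starOf (arcsOf Es))
  starEdges e = let a , sp = covered e in edge-in-star Es spans balanced (∈-toList⁺ (∈-lookupᵛ a f)) sp
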